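{- Let $\mathcal{C}$ be an $\mathcal{EL}^{++}$ CBox and let $A$ be a concept name. Let $t$ be an individual name and $r_t$ a role name, neither of which occurs in $\mathcal{C}$ (fresh names). Define the $A$-extension of $\mathcal{C}$ by $$\mathcal{C}^{A+} := \mathcal{C} \cup \{\, \{t\} \sqsubseteq \exists r_t.A \,\}.$$ Then for every concept name $B$, $$A \sqsubseteq_{\mathcal{C}} B \iff A \sqsubseteq_{\mathcal{C}^{A+}} B .$$
   Context: $\mathcal{EL}^{++}$ concept descriptions are built from pairwise disjoint sets $N_C$ (concept names), $N_R$ (role names), $N_I$ (individual names), $N_F$ (feature names), and finitely many concrete domains $\mathcal{D}_1,\dots,\mathcal{D}_n$ (each with a nonempty domain $\Delta^{\mathcal{D}_j}$ and a set $\mathcal{P}^{\mathcal{D}_j}$ of predicate names $p$, each with an arity $k$ and an extension $p^{\mathcal{D}_j}\subseteq(\Delta^{\mathcal{D}_j})^k$), by the grammar $C ::= \top \mid \bot \mid A \mid \{a\} \mid C \sqcap D \mid \exists r.C \mid p(f_1,\dots,f_k)$ with $A\in N_C$, $a\in N_I$, $r\in N_R$, $p\in\mathcal{P}^{\mathcal{D}_j}$ of arity $k$, $f_i\in N_F$. A CBox is a finite set of general concept inclusions $C \sqsubseteq D$ ($C,D$ concept descriptions) and role inclusions $r_1\circ\cdots\circ r_k \sqsubseteq r$ ($k\ge 1$, $r_i,r\in N_R$). An interpretation $\mathcal{I}$ consists of a nonempty set $\Delta^{\mathcal{I}}$ and a map sending each $A\in N_C$ to $A^{\mathcal{I}}\subseteq\Delta^{\mathcal{I}}$,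 each $r\in N_R$ to $r^{\mathcal{I}}\subseteq\Delta^{\mathcal{I}}\times\Delta^{\mathcal{I}}$, each $a\in N_I$ to $a^{\mathcal{I}}\in\Delta^{\mathcal{I}}$, and each $f\in N_F$ to a partial function $f^{\mathcal{I}}$ from $\Delta^{\mathcal{I}}$ to $\bigcup_j\Delta^{\mathcal{D}_j}$. It is extended to concept descriptions by $\top^{\mathcal{I}}=\Delta^{\mathcal{I}}$, $\bot^{\mathcal{I}}=\emptyset$, $\{a\}^{\mathcal{I}}=\{a^{\mathcal{I}}\}$, $(C\sqcap D)^{\mathcal{I}}=C^{\mathcal{I}}\cap D^{\mathcal{I}}$, $(\exists r.C)^{\mathcal{I}}=\{x\mid \exists y.\,(x,y)\in r^{\mathcal{I}}\wedge y\in C^{\mathcal{I}}\}$, $p(f_1,\dots,f_k)^{\mathcal{I}}=\{x\mid \exists d_1,\dots,d_k.\ f_i^{\mathcal{I}}(x)=d_i \text{ for all } i \text{ and } (d_1,\dots,d_k)\in p^{\mathcal{D}_j}\}$. $\mathcal{I}$ is a model of a CBox if $C^{\mathcal{I}}\subseteq D^{\mathcal{I}}$ for each GCI $C\sqsubseteq D$ in it and $r_1^{\mathcal{I}}\circ\cdots\circ r_k^{\mathcal{I}}\subseteq r^{\mathcal{I}}$ for each role inclusion in it. $C\sqsubseteq_{\mathcal{C}} D$ (subsumption w.r.t. $\mathcal{C}$) means $C^{\mathcal{I}}\subseteq D^{\mathcal{I}}$ for every model $\mathcal{I}$ of $\mathcal{C}$. -}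

module Defs where

open import Data.Nat using (ℕ)
open import Data.Fin using (Fin)
open import Data.Vec using (Vec; lookup)
open import Data.List using (List; []; _∷_; _++_; [_])
open import Data.Maybe using (Maybe; just)
open import Data.Product using (Σ; _×_; _,_)
open import Data.Unit using () renaming (⊤ to 𝟙)
open import Data.Empty using () renaming (⊥ to 𝟘)
open import Relation.Binary.PropositionalEquality using (_≡_)

-- Their domains are given as
-- subsets of a common value type V, so that the union ⋃ Δ^{D_j} (into which
-- features map) is literally the union of these subsets.
record ConcreteDomains : Set₁ where
  field
    n        : ℕ
    V        : Set
    dom      : Fin n → V → Set
    nonempty : (j : Fin n) → Σ V (dom j)
    Pred     : Fin n → Set
    arity    : (j : Fin n) → Pred j → ℕ
    ext      : (j : Fin n) (p : Pred j) → Vec V (arity j p) → Set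
    ext-dom  : (j : Fin n) (p : Pred j) (ds : Vec V (arity j p)) →
               ext j p ds → (i : Fin (arity j p)) → dom j (lookup ds i)

module EL (NC NR NI NF : Set) (CD : ConcreteDomains) where
  open ConcreteDomains CD

  data Concept : Set where
    ⊤'   : Concept
    ⊥'   : Concept
    atom : NC → Concept
    nom  : NI → Concept
    _⊓_  : Concept → Concept → Concept
    ∃'   : NR → Concept → Concept
    conc : (j : Fin n) (p : Pred j) → Vec NF (arity j p) → Concept

  data Axiom : Set where
    gci : Concept → Concept → Axiom
    ri  : NR → List NR → NR → Axiom                  -- r₁ ∘ r₂ ∘ … ∘ r_k ⊑ r  (k ≥ 1)

  CBox : Set
  CBox = List Axiom

  indsC : Concept → List NI
  indsC ⊤' = []
  indsC ⊥' = []
  indsC (atom _) = []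
  indsC (nom a) = [ a ]
  indsC (C ⊓ D) = indsC C ++ indsC D
  indsC (∃' _ C) = indsC C
  indsC (conc _ _ _) = []

  rolesC : Concept → List NR
  rolesC ⊤' = []
  rolesC ⊥' = []
  rolesC (atom _) = []
  rolesC (nom _) = []
  rolesC (C ⊓ D) = rolesC C ++ rolesC D
  rolesC (∃' r C) = r ∷ rolesC C
  rolesC (conc _ _ _) = []

  indsAx : Axiom → List NI
  indsAx (gci C D) = indsC C ++ indsC D
  indsAx (ri _ _ _) = []

  rolesAx : Axiom → List NR
  rolesAx (gci C D) = rolesC C ++ rolesC D
  rolesAx (ri r rs s) = r ∷ rs ++ [ s ]

  inds : CBox → List NI
  inds [] = []
  inds (ax ∷ C) = indsAx ax ++ inds C

  roles : CBox → List NR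
  roles [] = []
  roles (ax ∷ C) = rolesAx ax ++ roles C

  record Interpretation : Set₁ where
    field
      Δ     : Set
      elem  : Δ
      conI  : NC → Δ → Set
      roleI : NR → Δ → Δ → Set
      indI  : NI → Δ
      featI : NF → Δ → Maybe V
      featI-range : (f : NF) (x : Δ) (v : V) → featI f x ≡ just v →
                    Σ (Fin n) λ j → dom j v

  module _ (I : Interpretation) where
    open Interpretation I

    ⟦_⟧ : Concept → Δ → Set
    ⟦ ⊤' ⟧ x = 𝟙
    ⟦ ⊥' ⟧ x = 𝟘
    ⟦ atom A ⟧ x = conI A x
    ⟦ nom a ⟧ x = x ≡ indI a
    ⟦ C ⊓ D ⟧ x = ⟦ C ⟧ x × ⟦ D ⟧ x
    ⟦ ∃' r C ⟧ x = Σ Δ λ y → roleI r x y × ⟦ C ⟧ y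
    ⟦ conc j p fs ⟧ x = Σ (Vec V (arity j p)) λ ds →
        ((i : Fin (arity j p)) → featI (lookup fs i) x ≡ just (lookup ds i)) × ext j p ds

    chain : NR → List NR → Δ → Δ → Set
    chain r [] x y = roleI r x y
    chain r (s ∷ rs) x y = Σ Δ λ z → roleI r x z × chain s rs z y

    satAx : Axiom → Set
    satAx (gci C D) = (x : Δ) → ⟦ C ⟧ x → ⟦ D ⟧ x
    satAx (ri r rs s) = (x y : Δ) → chain r rs x y → roleI s x y

    Model : CBox → Set
    Model [] = 𝟙
    Model (ax ∷ C) = satAx ax × Model C

  _⊑⟨_⟩_ : Concept → CBox → Concept → Set₁
  C ⊑⟨ 𝒞 ⟩ D = (I : Interpretation) → Model I 𝒞 →
    (x : Interpretation.Δ I) → ⟦ I ⟧ C x → ⟦ I ⟧ D x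

  extension : CBox → NC → NI → NR → CBox
  extension 𝒞 A t rt = 𝒞 ++ [ gci (nom t) (∃' rt (atom A)) ]

{-# OPTIONS --safe #-}
-- Every model of 𝒞^{A+} is a model of 𝒞, which gives the forward direction.
-- Conversely, given a model I of 𝒞 and x ∈ A^I, add to r_t every pair (y, x).
-- EL⁺⁺ concepts are positive, so this can only enlarge their extensions, and
-- since r_t does not occur in 𝒞 the left-hand sides of its axioms are
-- unaffected; hence the result is still a model of 𝒞. Now every element, in
-- particular t, has an r_t-successor in A, so it is a model of 𝒞^{A+}, and
-- it interprets concept names as I does.
module Submission where

open import Defs
open import Data.List using ([]; _∷_; _++_)
open import Data.List.Membership.Propositional using (_∉_)
open import Data.List.Relation.Unary.All using (All; []; _∷_)
open import Data.List.Relation.Unary.All.Properties using (¬Any⇒All¬; ++⁻)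
open import Data.Product using (_×_; _,_)
open import Data.Sum using (_⊎_; inj₁; inj₂)
open import Data.Empty using (⊥-elim)
open import Data.Unit using (tt)
open import Relation.Binary.PropositionalEquality using (_≡_; _≢_; refl)

module _ {NC NR NI NF : Set} (CD : ConcreteDomains) where
  open EL NC NR NI NF CD
  open Interpretation

  Model-++⁻ˡ : (I : Interpretation) (𝒞 𝒟 : CBox) → Model I (𝒞 ++ 𝒟) → Model I 𝒞
  Model-++⁻ˡ I []      𝒟 _       = tt
  Model-++⁻ˡ I (_ ∷ 𝒞) 𝒟 (s , m) = s , Model-++⁻ˡ I 𝒞 𝒟 m

  Model-++⁺ : (I : Interpretation) (𝒞 𝒟 : CBox) → Model I 𝒞 → Model I 𝒟 → Model I (𝒞 ++ 𝒟)
  Model-++⁺ I []      𝒟 _       n = n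
  Model-++⁺ I (_ ∷ 𝒞) 𝒟 (s , m) n = s , Model-++⁺ I 𝒞 𝒟 m n

  ⊑⟨⟩-++ : ∀ {C D} (𝒞 𝒟 : CBox) → C ⊑⟨ 𝒞 ⟩ D → C ⊑⟨ 𝒞 ++ 𝒟 ⟩ D
  ⊑⟨⟩-++ 𝒞 𝒟 C⊑D I m = C⊑D I (Model-++⁻ˡ I 𝒞 𝒟 m)

  addRole : (I : Interpretation) → NR → (Δ I → Δ I → Set) → Interpretation
  addRole I rt R = record
    { Δ = Δ I ; elem = elem I ; conI = conI I
    ; roleI = λ r u v → roleI I r u v ⊎ (r ≡ rt × R u v)
    ; indI = indI I ; featI = featI I ; featI-range = featI-range I }

  module _ (I : Interpretation) (rt : NR) (R : Δ I → Δ I → Set) where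
    private
      I⁺ = addRole I rt R

    ⟦⟧-addRole⁺ : ∀ C y → ⟦ I ⟧ C y → ⟦ I⁺ ⟧ C y
    ⟦⟧-addRole⁺ ⊤'           y p             = p
    ⟦⟧-addRole⁺ ⊥'           y ()
    ⟦⟧-addRole⁺ (atom _)     y p             = p
    ⟦⟧-addRole⁺ (nom _)      y p             = p
    ⟦⟧-addRole⁺ (C ⊓ D)      y (p , q)       = ⟦⟧-addRole⁺ C y p , ⟦⟧-addRole⁺ D y q
    ⟦⟧-addRole⁺ (∃' r C)     y (z , ryz , p) = z , inj₁ ryz , ⟦⟧-addRole⁺ C z p
    ⟦⟧-addRole⁺ (conc _ _ _) y p             = p

    ⟦⟧-addRole⁻ : ∀ C → All (rt ≢_) (rolesC C) → ∀ y → ⟦ I⁺ ⟧ C y → ⟦ I ⟧ C y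
    ⟦⟧-addRole⁻ ⊤'           _ y p = p
    ⟦⟧-addRole⁻ ⊥'           _ y ()
    ⟦⟧-addRole⁻ (atom _)     _ y p = p
    ⟦⟧-addRole⁻ (nom _)      _ y p = p
    ⟦⟧-addRole⁻ (C ⊓ D) fresh y (p , q) with ++⁻ (rolesC C) fresh
    ... | freshC , freshD = ⟦⟧-addRole⁻ C freshC y p , ⟦⟧-addRole⁻ D freshD y q
    ⟦⟧-addRole⁻ (∃' r C) (_ ∷ freshC) y (z , inj₁ ryz , p) = z , ryz , ⟦⟧-addRole⁻ C freshC z p
    ⟦⟧-addRole⁻ (∃' r C) (rt≢r ∷ _)   y (z , inj₂ (refl , _) , _) = ⊥-elim (rt≢r refl)
    ⟦⟧-addRole⁻ (conc _ _ _) _ y p = p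

    chain-addRole⁻ : ∀ r rs → All (rt ≢_) (r ∷ rs) → ∀ u v → chain I⁺ r rs u v → chain I r rs u v
    chain-addRole⁻ r []       _           u v (inj₁ ruv)                = ruv
    chain-addRole⁻ r []       (rt≢r ∷ _)  u v (inj₂ (refl , _))         = ⊥-elim (rt≢r refl)
    chain-addRole⁻ r (s ∷ rs) (_ ∷ fresh) u v (z , inj₁ ruz , c)        = z , ruz , chain-addRole⁻ s rs fresh z v c
    chain-addRole⁻ r (s ∷ rs) (rt≢r ∷ _)  u v (z , inj₂ (refl , _) , _) = ⊥-elim (rt≢r refl)

    satAx-addRole : ∀ ax → All (rt ≢_) (rolesAx ax) → satAx I ax → satAx I⁺ ax
    satAx-addRole (gci C D) fresh C⊆D y p with ++⁻ (rolesC C) fresh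
    ... | freshC , _ = ⟦⟧-addRole⁺ D y (C⊆D y (⟦⟧-addRole⁻ C freshC y p))
    satAx-addRole (ri r rs s) (rt≢r ∷ fresh) chain⊆s u v c with ++⁻ rs fresh
    ... | freshRs , _ = inj₁ (chain⊆s u v (chain-addRole⁻ r rs (rt≢r ∷ freshRs) u v c))

    Model-addRole : ∀ 𝒞 → All (rt ≢_) (roles 𝒞) → Model I 𝒞 → Model I⁺ 𝒞
    Model-addRole []       _     _       = tt
    Model-addRole (ax ∷ 𝒞) fresh (s , m) with ++⁻ (rolesAx ax) fresh
    ... | freshAx , fresh𝒞 = satAx-addRole ax freshAx s , Model-addRole 𝒞 fresh𝒞 m

mainTheorem1 : {NC NR NI NF : Set} (CD : ConcreteDomains) →
    let open EL NC NR NI NF CD in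
    (𝒞 : CBox) (A : NC) (t : NI) (rt : NR) →
    t ∉ inds 𝒞 → rt ∉ roles 𝒞 →
    (B : NC) →
    ((atom A ⊑⟨ 𝒞 ⟩ atom B → atom A ⊑⟨ extension 𝒞 A t rt ⟩ atom B) ×
    (atom A ⊑⟨ extension 𝒞 A t rt ⟩ atom B → atom A ⊑⟨ 𝒞 ⟩ atom B))
mainTheorem1 CD 𝒞 A t rt _ rt∉𝒞 B = ⊑⟨⟩-++ CD 𝒞 _ , strengthen
  where
  open EL _ _ _ _ CD

  -- Every element gets an r_t-edge into x ∈ A.
  pointTo : (I : Interpretation) → Interpretation.Δ I → Interpretation
  pointTo I x = addRole CD I rt (λ _ v → v ≡ x)

  strengthen : atom A ⊑⟨ extension 𝒞 A t rt ⟩ atom B → atom A ⊑⟨ 𝒞 ⟩ atom B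
  strengthen A⊑B I m x a = A⊑B (pointTo I x) model⁺ x a
    where
    model⁺ : Model (pointTo I x) (extension 𝒞 A t rt)
    model⁺ = Model-++⁺ CD (pointTo I x) 𝒞 _
      (Model-addRole CD I rt _ 𝒞 (¬Any⇒All¬ _ rt∉𝒞) m)
      ((λ _ _ → x , inj₂ (refl , refl) , a) , tt)
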